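{- For every integer $n\ge2$ that is a power of 2 and $f=\mathsf{ADDR}_n$, $\mathsf{D}^{\rightarrow}_{\mathrm{cc}}(f\circ\mathsf{AND})\geq\mathrm{rank}(M_{f\circ\mathsf{AND}})^{\log_3 2}$.
   Context: $\mathsf{ADDR}_n:\{0,1\}^{\log n+n}\to\{0,1\}$ is $\mathsf{ADDR}_n(x,y)=y_{\mathsf{bin}(x)}$ for $x\in\{0,1\}^{\log n}$, $y\in\{0,1\}^n$, where $\mathsf{bin}(x)$ is the index in $[n]$ encoded in binary by $x$. For $f$ on $N$ bits, $f\circ\mathsf{AND}$ is the two-party function with Alice holding $u\in\{0,1\}^N$, Bob holding $v\in\{0,1\}^N$, and value $f(u_1\wedge v_1,\dots,u_N\wedge v_N)$. $M_F$ is the communication matrix $M_F(u,v)=F(u,v)$ and $\mathrm{rank}$ is real rank. $\mathsf{D}^{\rightarrow}_{\mathrm{cc}}$ is deterministic one-way communication complexity (Alice sends one message to Bob, who outputs; cost is maximum message length). -}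

module Defs where

open import Data.Nat using (ℕ; zero; suc; _+_; _^_; _≤_)
open import Data.Nat.Properties using (+-identityʳ)
open import Data.Bool using (Bool; true; false; _∧_; if_then_else_)
open import Data.Fin using (Fin; zero; suc)
open import Data.Vec using (Vec; []; _∷_; take; drop; cast; zipWith)
open import Data.Rational using (ℚ; 0ℚ; 1ℚ; _*_) renaming (_+_ to _+ℚ_)
open import Relation.Binary.PropositionalEquality using (_≡_)
open import Relation.Nullary using (¬_)
open import Data.Product using (Σ; ∃; _×_)

-- The addressing function ADDR_n for n = 2^k.
-- addrLookup x y = y_{bin(x)}, where x is read in binary, most
-- significant bit first, indices 0-based: the first bit selects the
-- first (false) or second (true) half of y.

addrLookup : ∀ k → Vec Bool k → Vec Bool (2 ^ k) → Bool
addrLookup zero    []       (b ∷ []) = b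
addrLookup (suc k) (b ∷ xs) y =
  if b then addrLookup k xs (cast (+-identityʳ (2 ^ k)) (drop (2 ^ k) y))
       else addrLookup k xs (take (2 ^ k) y)

ADDR : ∀ k → Vec Bool (k + 2 ^ k) → Bool
ADDR k z = addrLookup k (take k z) (drop k z)

_∘AND : ∀ {N} → (Vec Bool N → Bool) → Vec Bool N → Vec Bool N → Bool
(f ∘AND) u v = f (zipWith _∧_ u v)

toℚ : Bool → ℚ
toℚ true  = 1ℚ
toℚ false = 0ℚ

Matrix : Set → Set → Set
Matrix R C = R → C → ℚ

commMatrix : ∀ {N} → (Vec Bool N → Vec Bool N → Bool) → Matrix (Vec Bool N) (Vec Bool N)
commMatrix F u v = toℚ (F u v)

Σ[<_]_ : ∀ r → (Fin r → ℚ) → ℚ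
Σ[< zero ] g = 0ℚ
Σ[< suc r ] g = g zero +ℚ (Σ[< r ] λ i → g (suc i))

LinIndepRows : ∀ {R C} → Matrix R C → ∀ r → (Fin r → R) → Set
LinIndepRows {R} {C} M r ρ =
  (c : Fin r → ℚ) → (∀ (v : C) → (Σ[< r ] λ i → c i * M (ρ i) v) ≡ 0ℚ) →
  ∀ i → c i ≡ 0ℚ

-- rank M ≡ r : the maximum number of linearly independent rows is r.
-- (Rank over ℚ; for a rational matrix this equals the real rank.)
HasRank : ∀ {R C} → Matrix R C → ℕ → Set
HasRank {R} M r =
  (Σ (Fin r → R) λ ρ → LinIndepRows M r ρ) ×
  (¬ Σ (Fin (suc r) → R) λ ρ → LinIndepRows M (suc r) ρ)

-- Deterministic one-way protocols of cost c: Alice sends a c-bit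
-- message depending on her input, Bob outputs from message + his input.
-- D→(F) ≥ x  iff every such protocol computing F has c ≥ x.

record OneWayProtocol {A B : Set} (F : A → B → Bool) (c : ℕ) : Set where
  field
    msg     : A → Vec Bool c
    out     : Vec Bool c → B → Bool
    correct : ∀ a b → out (msg a) b ≡ F a b

-- c ≥ r ^ (log₃ 2), for naturals c, r, stated without reals:
-- equivalent to log₂ c ≥ log₃ r, which (by density of ℚ) is equivalent
-- to: for all p, q with q ≥ 1, 3^p ≤ r^q implies 2^p ≤ c^q.

_≥_^log₃2 : ℕ → ℕ → Set
c ≥ r ^log₃2 = ∀ (p q : ℕ) → 1 ≤ q → 3 ^ p ≤ r ^ q → 2 ^ p ≤ c ^ q

-- Alice's message must determine her table: if she holds (1…1, y) and Bob holds (x, 1…1),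
-- the bitwise AND of their inputs is (x, y), so Bob can read y at every address x; hence
-- c ≥ 2^k.  For the rank, let a and b be the first address bits of Alice and Bob.  An entry of
-- the matrix is  if a∧b then U else L  =  ab·U + L − ab·L,  where U and L are entries of the
-- matrix for k − 1 on the upper and lower halves of the tables: three rescaled copies of the
-- half-size matrix, so the rank is at most 3^k.  Hence c ≥ 2^k = (3^k)^(log₃ 2) ≥ rank^(log₃ 2).

module Submission where

open import Defs
open import Algebra.Bundles using (CommutativeRing)
open import Data.Bool using (Bool; true; false; _∧_; if_then_else_)
open import Data.Bool.Properties using (∧-identityˡ; ∧-identityʳ)
open import Data.Fin using (Fin; zero; suc; punchIn; punchOut; splitAt)
import Data.Fin.Properties as Finₚ
open import Data.Nat as ℕ using (ℕ; _≤_; _<_; _^_; s≤s; z≤n)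
import Data.Nat.Properties as ℕₚ
open import Data.Product using (∃; _×_; _,_; proj₁; proj₂)
open import Data.Rational using (ℚ; 0ℚ; 1ℚ; _+_; _*_; -_; 1/_; NonZero; ≢-nonZero; _≟_)
open import Data.Rational.Properties
  using (+-*-commutativeRing; +-identityˡ; +-identityʳ; +-assoc; +-comm;
         *-identityˡ; *-zeroˡ; *-zeroʳ; *-assoc; *-inverseˡ)
open import Data.Sum using (inj₁; inj₂)
open import Data.Vec using (Vec; []; _∷_; take; drop; cast; zipWith; replicate; head; _++_)
import Data.Vec.Properties as Vecₚ
open import Data.Vec.Functional as Vector using (Vector; tail)
open import Data.Vec.Recursive using (Fin[m^n]↔Fin[m]^n; lift↔)
open import Data.Vec.Recursive.Properties using (↔Vec)
open import Function using (_∘_; _↔_; _↣_; mk↣; Injection)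
open import Function.Definitions using (Injective)
open import Function.Properties.Inverse using (↔-sym; ↔-trans; ↔⇒↣)
open import Function.Construct.Composition using (_↣-∘_)
open import Relation.Binary.PropositionalEquality using (_≡_; _≢_; _≗_; refl; sym; trans; cong; cong₂; subst; module ≡-Reasoning)
open import Relation.Nullary using (¬_; yes; no)
open import Relation.Nullary.Decidable.Core using (dec⇒maybe)
open import Tactic.RingSolver using (solve-∀)
open import Tactic.RingSolver.Core.AlmostCommutativeRing using (AlmostCommutativeRing; fromCommutativeRing)
open import Algebra.Properties.Semiring.Sum (CommutativeRing.semiring +-*-commutativeRing)
  using (sum; sum-syntax; sum-cong-≗; sum-replicate-zero; ∑-distrib-+; ∑-comm;
         *-distribˡ-sum; *-distribʳ-sum)

ℚ-ring : AlmostCommutativeRing _ _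
ℚ-ring = fromCommutativeRing +-*-commutativeRing (λ x → dec⇒maybe (0ℚ ≟ x))

^-cancelˡ-≤ : ∀ {m n} b → 1 < b → b ^ m ≤ b ^ n → m ≤ n
^-cancelˡ-≤ b 1<b bᵐ≤bⁿ = ℕₚ.≮⇒≥ λ n<m → ℕₚ.<⇒≱ (ℕₚ.^-monoʳ-< b 1<b n<m) bᵐ≤bⁿ

Σ[<]≡sum : ∀ r (g : Vector ℚ r) → (Σ[< r ] g) ≡ sum g
Σ[<]≡sum ℕ.zero    g = refl
Σ[<]≡sum (ℕ.suc r) g = cong (g zero +_) (Σ[<]≡sum r (tail g))

tail-++ : ∀ {A : Set} {m n} (xs : Vector A (ℕ.suc m)) (ys : Vector A n) →
          tail (xs Vector.++ ys) ≗ tail xs Vector.++ ys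
tail-++ {m = m} xs ys i with splitAt m i
... | inj₁ _ = refl
... | inj₂ _ = refl

zipWith-++ : ∀ {A B C : Set} {m n} (f : A → B → C)
             (xs : Vector A m) (ys : Vector A n) (xs′ : Vector B m) (ys′ : Vector B n) →
             Vector.zipWith f (xs Vector.++ ys) (xs′ Vector.++ ys′) ≗
             Vector.zipWith f xs xs′ Vector.++ Vector.zipWith f ys ys′
zipWith-++ {m = m} f xs ys xs′ ys′ t with splitAt m t
... | inj₁ _ = refl
... | inj₂ _ = refl

sum-++ : ∀ {m n} (xs : Vector ℚ m) (ys : Vector ℚ n) → sum (xs Vector.++ ys) ≡ sum xs + sum ys
sum-++ {ℕ.zero}  xs ys = sym (+-identityˡ (sum ys))
sum-++ {ℕ.suc m} xs ys = begin
  xs zero + sum (tail (xs Vector.++ ys)) ≡⟨ cong (xs zero +_) (sum-cong-≗ (tail-++ xs ys)) ⟩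
  xs zero + sum (tail xs Vector.++ ys)   ≡⟨ cong (xs zero +_) (sum-++ (tail xs) ys) ⟩
  xs zero + (sum (tail xs) + sum ys)     ≡⟨ sym (+-assoc (xs zero) _ _) ⟩
  sum xs + sum ys                        ∎
  where open ≡-Reasoning

LinearRelation : ∀ {m R} → (Fin m → Fin R → ℚ) → Vector ℚ m → Set
LinearRelation {m} A c = ∀ t → ∑[ i < m ] (c i * A i t) ≡ 0ℚ

LinearlyDependent : ∀ {m R} → (Fin m → Fin R → ℚ) → Set
LinearlyDependent A = ∃ λ c → LinearRelation A c × ∃ λ i → c i ≢ 0ℚ

zeroRow⇒dependent : ∀ {m R} (A : Fin (ℕ.suc m) → Fin R → ℚ) →
                    (∀ t → A zero t ≡ 0ℚ) → LinearlyDependent A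
zeroRow⇒dependent {m} A A₀≡0 = 1ℚ Vector.∷ (λ _ → 0ℚ) , relation , zero , λ ()
  where
  relation : LinearRelation A (1ℚ Vector.∷ λ _ → 0ℚ)
  relation t = cong₂ _+_ (trans (*-identityˡ _) (A₀≡0 t))
                         (trans (sum-cong-≗ (λ i → *-zeroˡ (A (suc i) t))) (sum-replicate-zero m))

rowReduce : ∀ {m R} → (Fin (ℕ.suc m) → Fin R → ℚ) → Vector ℚ m → Fin m → Fin R → ℚ
rowReduce A μ i t = A (suc i) t + μ i * A zero t

rowReduce-relation : ∀ {m R} (A : Fin (ℕ.suc m) → Fin R → ℚ) (μ d : Vector ℚ m) t →
  ∑[ i < ℕ.suc m ] ((∑[ j < m ] (d j * μ j) Vector.∷ d) i * A i t) ≡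
  ∑[ i < m ] (d i * rowReduce A μ i t)
rowReduce-relation {m} A μ d t = begin
  dμ * a + dA                            ≡⟨ +-comm (dμ * a) dA ⟩
  dA + dμ * a                            ≡⟨ cong (dA +_) (*-distribʳ-sum a (λ j → d j * μ j)) ⟩
  dA + ∑[ i < m ] (d i * μ i * a)        ≡⟨ sym (∑-distrib-+ (λ i → d i * A (suc i) t) _) ⟩
  ∑[ i < m ] (d i * A (suc i) t + d i * μ i * a)
                                         ≡⟨ sum-cong-≗ (λ i → distrib (d i) (A (suc i) t) (μ i) a) ⟩
  ∑[ i < m ] (d i * rowReduce A μ i t)   ∎
  where
  open ≡-Reasoning
  a  = A zero t
  dμ = ∑[ j < m ] (d j * μ j)
  dA = ∑[ i < m ] (d i * A (suc i) t)
  distrib : ∀ d x μ a → d * x + d * μ * a ≡ d * (x + μ * a)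
  distrib = solve-∀ ℚ-ring

eliminationMultipliers : ∀ {m R} (A : Fin (ℕ.suc m) → Fin R → ℚ) t₀ .{{_ : NonZero (A zero t₀)}} →
                         Vector ℚ m
eliminationMultipliers A t₀ i = - (A (suc i) t₀ * 1/ A zero t₀)

eliminate : ∀ {m R} (A : Fin (ℕ.suc m) → Fin R → ℚ) t₀ .{{_ : NonZero (A zero t₀)}} →
            Fin m → Fin R → ℚ
eliminate A t₀ = rowReduce A (eliminationMultipliers A t₀)

eliminate-pivotColumn : ∀ {m R} (A : Fin (ℕ.suc m) → Fin R → ℚ) t₀ .{{_ : NonZero (A zero t₀)}} i →
                        eliminate A t₀ i t₀ ≡ 0ℚ
eliminate-pivotColumn A t₀ i = begin
  x + - (x * 1/ p) * p  ≡⟨ expand x (1/ p) p ⟩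
  x + - (x * (1/ p * p)) ≡⟨ cong (λ y → x + - (x * y)) (*-inverseˡ p) ⟩
  x + - (x * 1ℚ)        ≡⟨ cancel x ⟩
  0ℚ                    ∎
  where
  open ≡-Reasoning
  x = A (suc i) t₀
  p = A zero t₀
  expand : ∀ x q p → x + - (x * q) * p ≡ x + - (x * (q * p))
  expand = solve-∀ ℚ-ring
  cancel : ∀ x → x + - (x * 1ℚ) ≡ 0ℚ
  cancel = solve-∀ ℚ-ring

pivot⇒dependent : ∀ {m R} (A : Fin (ℕ.suc m) → Fin (ℕ.suc R) → ℚ) t₀ .{{_ : NonZero (A zero t₀)}} →
                  LinearlyDependent (λ i t → eliminate A t₀ i (punchIn t₀ t)) → LinearlyDependent A
pivot⇒dependent {m} A t₀ (d , relation , j , dⱼ≢0) =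
  c , (λ t → trans (rowReduce-relation A μ d t) (reducedRelation t)) , suc j , dⱼ≢0
  where
  μ = eliminationMultipliers A t₀
  c = ∑[ i < m ] (d i * μ i) Vector.∷ d
  reducedRelation : ∀ t → ∑[ i < m ] (d i * eliminate A t₀ i t) ≡ 0ℚ
  reducedRelation t with t Finₚ.≟ t₀
  ... | yes refl = trans (sum-cong-≗ (λ i → trans (cong (d i *_) (eliminate-pivotColumn A t₀ i))
                                                  (*-zeroʳ (d i))))
                         (sum-replicate-zero m)
  ... | no t≢t₀ = subst (λ t → ∑[ i < m ] (d i * eliminate A t₀ i t) ≡ 0ℚ)
                        (Finₚ.punchIn-punchOut t₀≢t) (relation (punchOut t₀≢t))
    where t₀≢t = t≢t₀ ∘ sym

<⇒dependent : ∀ {m R} → R < m → (A : Fin m → Fin R → ℚ) → LinearlyDependent A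
<⇒dependent {ℕ.suc m} {ℕ.zero}  _          A = (λ _ → 1ℚ) , (λ ()) , zero , λ ()
<⇒dependent {ℕ.suc m} {ℕ.suc R} (s≤s R<m) A with Finₚ.all? (λ t → A zero t ≟ 0ℚ)
... | yes A₀≡0 = zeroRow⇒dependent A A₀≡0
... | no  A₀≢0 with Finₚ.¬∀⟶∃¬ (ℕ.suc R) _ (λ t → A zero t ≟ 0ℚ) A₀≢0
...   | t₀ , p≢0 = pivot⇒dependent A t₀ {{≢-nonZero p≢0}} (<⇒dependent R<m _)

record RankOneDecomposition {Row Col : Set} (M : Matrix Row Col) (R : ℕ) : Set where
  field
    left       : Vector (Row → ℚ) R
    right      : Vector (Col → ℚ) R
    decomposes : ∀ u v → M u v ≡ ∑[ t < R ] (left t u * right t v)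

  terms : Row → Col → Vector ℚ R
  terms u v t = left t u * right t v

rank≤length : ∀ {Row Col} {M : Matrix Row Col} {r R} →
              HasRank M r → RankOneDecomposition M R → r ≤ R
rank≤length {M = M} {r} {R} ((ρ , independent) , _) D = ℕₚ.≮⇒≥ R≮r
  where
  open RankOneDecomposition D
  R≮r : ¬ R < r
  R≮r R<r with <⇒dependent R<r (λ i t → left t (ρ i))
  ... | c , relation , j , cⱼ≢0 = cⱼ≢0 (independent c annihilates j)
    where
    open ≡-Reasoning
    annihilates : ∀ v → (Σ[< r ] λ i → c i * M (ρ i) v) ≡ 0ℚ
    annihilates v = begin
      (Σ[< r ] λ i → c i * M (ρ i) v)
        ≡⟨ Σ[<]≡sum r _ ⟩
      ∑[ i < r ] (c i * M (ρ i) v)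
        ≡⟨ sum-cong-≗ (λ i → cong (c i *_) (decomposes (ρ i) v)) ⟩
      ∑[ i < r ] (c i * ∑[ t < R ] (left t (ρ i) * right t v))
        ≡⟨ sum-cong-≗ (λ i → *-distribˡ-sum (c i) (λ t → left t (ρ i) * right t v)) ⟩
      ∑[ i < r ] ∑[ t < R ] (c i * (left t (ρ i) * right t v))
        ≡⟨ ∑-comm (λ i t → c i * (left t (ρ i) * right t v)) ⟩
      ∑[ t < R ] ∑[ i < r ] (c i * (left t (ρ i) * right t v))
        ≡⟨ sum-cong-≗ (λ t → sum-cong-≗ {r} (λ i → sym (*-assoc (c i) (left t (ρ i)) (right t v)))) ⟩
      ∑[ t < R ] ∑[ i < r ] (c i * left t (ρ i) * right t v)
        ≡⟨ sum-cong-≗ (λ t → sym (*-distribʳ-sum (right t v) (λ i → c i * left t (ρ i)))) ⟩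
      ∑[ t < R ] (∑[ i < r ] (c i * left t (ρ i)) * right t v)
        ≡⟨ sum-cong-≗ (λ t → trans (cong (_* right t v) (relation t)) (*-zeroˡ (right t v))) ⟩
      ∑[ t < R ] 0ℚ
        ≡⟨ sum-replicate-zero R ⟩
      0ℚ ∎

module _ {Row Col : Set} where

  rankOne : (α : Row → ℚ) (β : Col → ℚ) → RankOneDecomposition (λ u v → α u * β v) 1
  rankOne α β = record
    { left = λ _ → α ; right = λ _ → β ; decomposes = λ u v → sym (+-identityʳ (α u * β v)) }

  empty : RankOneDecomposition {Row} {Col} (λ _ _ → 0ℚ) 0
  empty = record { left = λ () ; right = λ () ; decomposes = λ _ _ → refl }

  respects : ∀ {M N : Matrix Row Col} {R} →
             (∀ u v → N u v ≡ M u v) → RankOneDecomposition M R → RankOneDecomposition N R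
  respects N≡M D = record { RankOneDecomposition D ; decomposes = λ u v → trans (N≡M u v) (decomposes u v) }
    where open RankOneDecomposition D

  scale : ∀ {M : Matrix Row Col} {R} (α : Row → ℚ) (β : Col → ℚ) →
          RankOneDecomposition M R → RankOneDecomposition (λ u v → (α u * β v) * M u v) R
  scale {M} {R} α β D = record
    { left       = λ t u → α u * left t u
    ; right      = λ t v → β v * right t v
    ; decomposes = λ u v → begin
        (α u * β v) * M u v                               ≡⟨ cong ((α u * β v) *_) (decomposes u v) ⟩
        (α u * β v) * ∑[ t < R ] (left t u * right t v)   ≡⟨ *-distribˡ-sum (α u * β v) (λ t → left t u * right t v) ⟩
        ∑[ t < R ] ((α u * β v) * (left t u * right t v)) ≡⟨ sum-cong-≗ (λ t → interchange (α u) (β v) (left t u) (right t v)) ⟩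
        ∑[ t < R ] ((α u * left t u) * (β v * right t v)) ∎
    }
    where
    open RankOneDecomposition D
    open ≡-Reasoning
    interchange : ∀ a b x y → (a * b) * (x * y) ≡ (a * x) * (b * y)
    interchange = solve-∀ ℚ-ring

  _⊕_ : ∀ {M N : Matrix Row Col} {a b} → RankOneDecomposition M a → RankOneDecomposition N b →
        RankOneDecomposition (λ u v → M u v + N u v) (a ℕ.+ b)
  _⊕_ {M} {N} {a} {b} D E = record
    { left       = D.left Vector.++ E.left
    ; right      = D.right Vector.++ E.right
    ; decomposes = λ u v → begin
        M u v + N u v
          ≡⟨ cong₂ _+_ (D.decomposes u v) (E.decomposes u v) ⟩
        sum (D.terms u v) + sum (E.terms u v)
          ≡⟨ sum-++ (D.terms u v) (E.terms u v) ⟨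
        sum (D.terms u v Vector.++ E.terms u v)
          ≡⟨ sum-cong-≗ (zipWith-++ (λ l r → l u * r v) D.left E.left D.right E.right) ⟨
        ∑[ t < a ℕ.+ b ] ((D.left Vector.++ E.left) t u * (D.right Vector.++ E.right) t v) ∎
    }
    where
    module D = RankOneDecomposition D
    module E = RankOneDecomposition E
    open ≡-Reasoning

  infixr 5 _⊕_

  reindex : ∀ {Row′ Col′ : Set} {M : Matrix Row Col} {R} (f : Row′ → Row) (g : Col′ → Col) →
            RankOneDecomposition M R → RankOneDecomposition (λ u v → M (f u) (g v)) R
  reindex f g D = record
    { left = λ t → left t ∘ f ; right = λ t → right t ∘ g ; decomposes = λ u v → decomposes (f u) (g v) }
    where open RankOneDecomposition D

AddrInput : ℕ → Set
AddrInput k = Vec Bool k × Vec Bool (2 ^ k)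

addrMatrix : ∀ k → Matrix (AddrInput k) (AddrInput k)
addrMatrix k (x , y) (x′ , y′) = toℚ (addrLookup k (zipWith _∧_ x x′) (zipWith _∧_ y y′))

lowerHalf upperHalf : ∀ k → Vec Bool (2 ^ ℕ.suc k) → Vec Bool (2 ^ k)
lowerHalf k y = take (2 ^ k) y
upperHalf k y = cast (ℕₚ.+-identityʳ (2 ^ k)) (drop (2 ^ k) y)

cast-zipWith : ∀ {A B C : Set} {m n} .(eq : m ≡ n) (f : A → B → C) (xs : Vec A m) (ys : Vec B m) →
               cast eq (zipWith f xs ys) ≡ zipWith f (cast eq xs) (cast eq ys)
cast-zipWith {n = ℕ.zero}  eq f []       []       = refl
cast-zipWith {n = ℕ.suc n} eq f (x ∷ xs) (y ∷ ys) = cong (f x y ∷_) (cast-zipWith (ℕₚ.suc-injective eq) f xs ys)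

lowerHalf-zipWith : ∀ k (y y′ : Vec Bool (2 ^ ℕ.suc k)) →
                    lowerHalf k (zipWith _∧_ y y′) ≡ zipWith _∧_ (lowerHalf k y) (lowerHalf k y′)
lowerHalf-zipWith k = Vecₚ.take-zipWith {m = 2 ^ k} _∧_

upperHalf-zipWith : ∀ k (y y′ : Vec Bool (2 ^ ℕ.suc k)) →
                    upperHalf k (zipWith _∧_ y y′) ≡ zipWith _∧_ (upperHalf k y) (upperHalf k y′)
upperHalf-zipWith k y y′ =
  trans (cong (cast (ℕₚ.+-identityʳ (2 ^ k))) (Vecₚ.drop-zipWith {m = 2 ^ k} _∧_ y y′))
        (cast-zipWith (ℕₚ.+-identityʳ (2 ^ k)) _∧_ (drop (2 ^ k) y) (drop (2 ^ k) y′))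

firstBit : ∀ {k} → AddrInput (ℕ.suc k) → ℚ
firstBit (b ∷ _ , _) = toℚ b

lower upper : ∀ {k} → AddrInput (ℕ.suc k) → AddrInput k
lower {k} (_ ∷ x , y) = x , lowerHalf k y
upper {k} (_ ∷ x , y) = x , upperHalf k y

toℚ-if-∧ : ∀ a b (p q : Bool) → toℚ (if a ∧ b then p else q) ≡
           (toℚ a * toℚ b) * toℚ p + (toℚ q + (((- toℚ a) * toℚ b) * toℚ q + 0ℚ))
toℚ-if-∧ true  true  true  true  = refl
toℚ-if-∧ true  true  true  false = refl
toℚ-if-∧ true  true  false true  = refl
toℚ-if-∧ true  true  false false = refl
toℚ-if-∧ true  false true  true  = refl
toℚ-if-∧ true  false true  false = refl
toℚ-if-∧ true  false false true  = refl
toℚ-if-∧ true  false false false = refl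
toℚ-if-∧ false true  true  true  = refl
toℚ-if-∧ false true  true  false = refl
toℚ-if-∧ false true  false true  = refl
toℚ-if-∧ false true  false false = refl
toℚ-if-∧ false false true  true  = refl
toℚ-if-∧ false false true  false = refl
toℚ-if-∧ false false false true  = refl
toℚ-if-∧ false false false false = refl

addrMatrix-zero : ∀ u v → addrMatrix 0 u v ≡ toℚ (head (proj₂ u)) * toℚ (head (proj₂ v))
addrMatrix-zero ([] , true  ∷ []) ([] , true  ∷ []) = refl
addrMatrix-zero ([] , true  ∷ []) ([] , false ∷ []) = refl
addrMatrix-zero ([] , false ∷ []) ([] , true  ∷ []) = refl
addrMatrix-zero ([] , false ∷ []) ([] , false ∷ []) = refl

addrMatrix-suc : ∀ k u v → addrMatrix (ℕ.suc k) u v ≡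
  (firstBit u * firstBit v) * addrMatrix k (upper u) (upper v) +
  (addrMatrix k (lower u) (lower v) +
  (((- firstBit u) * firstBit v) * addrMatrix k (lower u) (lower v) + 0ℚ))
addrMatrix-suc k (b ∷ x , y) (b′ ∷ x′ , y′)
  rewrite upperHalf-zipWith k y y′ | lowerHalf-zipWith k y y′ = toℚ-if-∧ b b′ _ _

addrDecomposition : ∀ k → RankOneDecomposition (addrMatrix k) (3 ^ k)
addrDecomposition ℕ.zero    = respects addrMatrix-zero (rankOne (toℚ ∘ head ∘ proj₂) (toℚ ∘ head ∘ proj₂))
addrDecomposition (ℕ.suc k) = respects (addrMatrix-suc k)
  (scale firstBit firstBit (reindex upper upper D) ⊕
   reindex lower lower D ⊕
   scale (-_ ∘ firstBit) firstBit (reindex lower lower D) ⊕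
   empty)
  where D = addrDecomposition k

split : ∀ k → Vec Bool (k ℕ.+ 2 ^ k) → AddrInput k
split k z = take k z , drop k z

commMatrix-ADDR∘AND : ∀ k u v → commMatrix (ADDR k ∘AND) u v ≡ addrMatrix k (split k u) (split k v)
commMatrix-ADDR∘AND k u v =
  cong₂ (λ x y → toℚ (addrLookup k x y)) (Vecₚ.take-zipWith {m = k} _∧_ u v) (Vecₚ.drop-zipWith {m = k} _∧_ u v)

rank-ADDR∘AND≤3^k : ∀ k {r} → HasRank (commMatrix (ADDR k ∘AND)) r → r ≤ 3 ^ k
rank-ADDR∘AND≤3^k k rank =
  rank≤length rank (respects (commMatrix-ADDR∘AND k) (reindex (split k) (split k) (addrDecomposition k)))

Vec-Bool↔Fin : ∀ n → Vec Bool n ↔ Fin (2 ^ n)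
Vec-Bool↔Fin n = ↔-sym (↔-trans (Fin[m^n]↔Fin[m]^n 2 n) (↔-trans (lift↔ n Finₚ.2↔Bool) (↔Vec n)))

injective⇒length≤ : ∀ {m n} (f : Vec Bool m → Vec Bool n) → Injective _≡_ _≡_ f → m ≤ n
injective⇒length≤ {m} {n} f f-injective =
  ^-cancelˡ-≤ 2 (s≤s (s≤s z≤n)) (Finₚ.injective⇒≤ (Injection.injective fin-injection))
  where
  fin-injection : Fin (2 ^ m) ↣ Fin (2 ^ n)
  fin-injection = ↔⇒↣ (Vec-Bool↔Fin n) ↣-∘ (mk↣ f-injective ↣-∘ ↔⇒↣ (↔-sym (Vec-Bool↔Fin m)))

cast-injective : ∀ {A : Set} {m n} .(eq : m ≡ n) {xs ys : Vec A m} → cast eq xs ≡ cast eq ys → xs ≡ ys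
cast-injective eq same = trans (sym (Vecₚ.cast-sym eq same)) (Vecₚ.cast-sym eq refl)

addrLookup-ext : ∀ k {y y′ : Vec Bool (2 ^ k)} → (∀ x → addrLookup k x y ≡ addrLookup k x y′) → y ≡ y′
addrLookup-ext ℕ.zero {_ ∷ []} {_ ∷ []} same = cong (_∷ []) (same [])
addrLookup-ext (ℕ.suc k) {y} {y′} same = begin
  y                                  ≡⟨ Vecₚ.take++drop≡id (2 ^ k) y ⟨
  take (2 ^ k) y ++ drop (2 ^ k) y   ≡⟨ cong₂ _++_ sameLower sameUpper ⟩
  take (2 ^ k) y′ ++ drop (2 ^ k) y′ ≡⟨ Vecₚ.take++drop≡id (2 ^ k) y′ ⟩
  y′                                 ∎
  where
  open ≡-Reasoning
  sameLower : lowerHalf k y ≡ lowerHalf k y′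
  sameLower = addrLookup-ext k (λ x → same (false ∷ x))
  sameUpper : drop (2 ^ k) y ≡ drop (2 ^ k) y′
  sameUpper = cast-injective (ℕₚ.+-identityʳ (2 ^ k)) (addrLookup-ext k (λ x → same (true ∷ x)))

take-drop-++ : ∀ {A : Set} {m n} (xs : Vec A m) (ys : Vec A n) →
               take m (xs ++ ys) ≡ xs × drop m (xs ++ ys) ≡ ys
take-drop-++ {m = m} xs ys = Vecₚ.++-injective (take m (xs ++ ys)) xs (Vecₚ.take++drop≡id m (xs ++ ys))

ADDR∘AND-reads-table : ∀ k x y →
  (ADDR k ∘AND) (replicate k true ++ y) (x ++ replicate (2 ^ k) true) ≡ addrLookup k x y
ADDR∘AND-reads-table k x y = begin
  ADDR k (zipWith _∧_ (replicate k true ++ y) (x ++ replicate (2 ^ k) true))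
    ≡⟨ cong (ADDR k) (Vecₚ.zipWith-++ _∧_ (replicate k true) y x (replicate (2 ^ k) true)) ⟩
  ADDR k (zipWith _∧_ (replicate k true) x ++ zipWith _∧_ y (replicate (2 ^ k) true))
    ≡⟨ cong (ADDR k) (cong₂ _++_ (Vecₚ.zipWith-identityˡ ∧-identityˡ x) (Vecₚ.zipWith-identityʳ ∧-identityʳ y)) ⟩
  ADDR k (x ++ y)
    ≡⟨ cong₂ (addrLookup k) (proj₁ (take-drop-++ x y)) (proj₂ (take-drop-++ x y)) ⟩
  addrLookup k x y ∎
  where open ≡-Reasoning

message-length : ∀ k {c} → OneWayProtocol (ADDR k ∘AND) c → 2 ^ k ≤ c
message-length k P = injective⇒length≤ (λ y → msg (replicate k true ++ y)) messageInjective
  where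
  open OneWayProtocol P
  bobQueries : ∀ x → Vec Bool (k ℕ.+ 2 ^ k)
  bobQueries x = x ++ replicate (2 ^ k) true
  bobReads : ∀ y x → out (msg (replicate k true ++ y)) (bobQueries x) ≡ addrLookup k x y
  bobReads y x = trans (correct _ _) (ADDR∘AND-reads-table k x y)
  messageInjective : Injective _≡_ _≡_ (λ y → msg (replicate k true ++ y))
  messageInjective {y} {y′} sameMessage = addrLookup-ext k λ x → begin
    addrLookup k x y                            ≡⟨ bobReads y x ⟨
    out (msg (replicate k true ++ y)) (bobQueries x)  ≡⟨ cong (λ m → out m (bobQueries x)) sameMessage ⟩
    out (msg (replicate k true ++ y′)) (bobQueries x) ≡⟨ bobReads y′ x ⟩
    addrLookup k x y′                           ∎
    where open ≡-Reasoning

powers⇒≥^log₃2 : ∀ k {c r} → 2 ^ k ≤ c → r ≤ 3 ^ k → c ≥ r ^log₃2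
powers⇒≥^log₃2 k {c} {r} 2ᵏ≤c r≤3ᵏ p q _ 3ᵖ≤rᑫ = begin
  2 ^ p          ≤⟨ ℕₚ.^-monoʳ-≤ 2 p≤kq ⟩
  2 ^ (k ℕ.* q)  ≡⟨ ℕₚ.^-*-assoc 2 k q ⟨
  (2 ^ k) ^ q    ≤⟨ ℕₚ.^-monoˡ-≤ q 2ᵏ≤c ⟩
  c ^ q          ∎
  where
  open ℕₚ.≤-Reasoning
  p≤kq : p ≤ k ℕ.* q
  p≤kq = ^-cancelˡ-≤ 3 (s≤s (s≤s z≤n)) (begin
    3 ^ p          ≤⟨ 3ᵖ≤rᑫ ⟩
    r ^ q          ≤⟨ ℕₚ.^-monoˡ-≤ q r≤3ᵏ ⟩
    (3 ^ k) ^ q    ≡⟨ ℕₚ.^-*-assoc 3 k q ⟩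
    3 ^ (k ℕ.* q)  ∎)

corollary1 : ∀ (k : ℕ) → 1 ≤ k → ∀ (c r : ℕ) →
    OneWayProtocol (ADDR k ∘AND) c →
    HasRank (commMatrix (ADDR k ∘AND)) r →
    c ≥ r ^log₃2
corollary1 k _ c r protocol rank =
  powers⇒≥^log₃2 k (message-length k protocol) (rank-ADDR∘AND≤3^k k rank)
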